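{- Let $m\ge 3$ and $1<c_2<c_3<\cdots<c_m<c_{m+1}$ be natural numbers, and let $\$_1=\langle 1,c_2,c_3\rangle$, $\$_2=\langle 1,c_2,\dots,c_m\rangle$ and $\$_3=\langle 1,c_2,\dots,c_m,c_{m+1}\rangle$ be three tight coin systems such that $\$_1$ is canonical and both $\$_2$ and $\$_3$ are non-canonical. Suppose $\$_3$ has no counterexample $x$ such that either $x=c_m+c_i>c_{m+1}$ for some $2\le i\le m$, or $x=c_{m-1}+c_j>c_{m+1}$ for some $2\le j\le m$. Then the smallest counterexample of $\$_3$ is the sum of two coins of $\$_3$.
   Context: A coin system is a tuple $\$=\langle c_1,\dots,c_m\rangle$ of natural numbers with $1=c_1<c_2<\cdots<c_m$. A representation of $x$ is a tuple $(\alpha_1,\dots,\alpha_m)$ of natural numbers with $\sum_i\alpha_ic_i=x$, of size $\sum_i\alpha_i$. The greedy representation $\mathrm{GRD}_{\$}(x)$ is the representation with $\sum_{j<i}\alpha_jc_j<c_i$ for all $2\le i\le m$; $\mathrm{OPT}_{\$}(x)$ is a representation of minimum size. A counterexample of $\$$ is a natural number $x$ with $|\mathrm{GRD}_{\$}(x)|>|\mathrm{OPT}_{\$}(x)|$; $\$$ is canonical if it has no counterexample and non-canonical otherwise. $\$$ is tight if it has no counterexample smaller than its largest coin $c_m$. -}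

module Defs where

open import Data.Nat using (ℕ; zero; suc; _+_; _*_; _∸_; _<_; _≤_; _⊔_)
open import Data.Nat.ListAction using (sum)
open import Data.List using (List; []; _∷_; length; zipWith; take; lookup; foldr; map; upTo)
open import Data.Fin using (fromℕ<)
open import Data.Product using (Σ; _×_)
open import Relation.Binary.PropositionalEquality using (_≡_)
open import Relation.Nullary using (¬_)

-- A coin system ⟨c_1,…,c_m⟩ is represented by the list [c_1, …, c_m]
-- (list position k, 0-based, holds c_(k+1)).

largest : List ℕ → ℕ
largest = foldr _⊔_ 0

value : List ℕ → List ℕ → ℕ
value α cs = sum (zipWith _*_ α cs)

record Rep (cs : List ℕ) (x : ℕ) : Set where
  constructor rep
  field
    coeffs : List ℕ
    len    : length coeffs ≡ length cs
    val    : value coeffs cs ≡ x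

open Rep public

size : ∀ {cs x} → Rep cs x → ℕ
size r = sum (coeffs r)

-- Greedy condition: Σ_{j<i} α_j c_j < c_i for all 2 ≤ i ≤ m
-- (0-based: for every position k with 1 ≤ k < m, the first k terms sum below cs[k]).
IsGreedy : ∀ {cs x} → Rep cs x → Set
IsGreedy {cs} r =
  ∀ k (k<m : k < length cs) → 1 ≤ k →
    value (take k (coeffs r)) (take k cs) < lookup cs (fromℕ< k<m)

Counterexample : List ℕ → ℕ → Set
Counterexample cs x =
  Σ (Rep cs x) λ g → IsGreedy g × Σ (Rep cs x) λ r → size r < size g

Canonical : List ℕ → Set
Canonical cs = ∀ x → ¬ Counterexample cs x

Tight : List ℕ → Set
Tight cs = ∀ x → x < largest cs → ¬ Counterexample cs x

-- ⟨1, c_2, …, c_k⟩ for a sequence c (only c_2,…,c_k are used)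
system : (ℕ → ℕ) → ℕ → List ℕ
system c k = 1 ∷ map (λ i → c (2 + i)) (upTo (k ∸ 1))

-- Write L = c_(m+1), cm = c_m and gap = L − cm. If gap ≥ cm, tightness of $₃ forces $₂ to be
-- canonical, so gap < cm; and by hypothesis a − gap is a coin for every coin a ≠ L exceeding gap
-- (else cm + a = L + (a − gap) is a counterexample). Let x ≥ L be the least counterexample of $₃,
-- O a coin list for x shorter than greedy and r = x − L. By minimality any part of O may be
-- replaced by its greedy representation, which forces: L ∉ O, every coin of O exceeds r, and cm
-- never occurs alongside a coin b > gap (trade them for L and b − gap). If r < gap, O has, after
-- regreedying a prefix if need be, a coin a > gap, and trading a for a − gap gives a short list
-- for cm + r < x. If r ≥ gap, write O = a ∷ S with sum S < cm and let G be the largest coin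
-- ≤ sum S; descending cm, cm − gap, … through coins shows sum S < G + gap, so regreedying S gives
-- a ∷ G ∷ N with a + G ≥ cm, which is impossible unless N is empty, i.e. x = a + G.

module Submission where

open import Defs
open import Data.Empty using (⊥; ⊥-elim)
open import Data.Fin using (fromℕ<)
open import Data.List using (List; []; _∷_; [_]; _++_; _∷ʳ_; length; take; lookup; map; upTo; replicate)
open import Data.List.Properties using (length-++; length-replicate; map-++; map-upTo; upTo-∷ʳ)
open import Data.List.Membership.Propositional using (_∈_; _∉_; find)
open import Data.List.Membership.Propositional.Properties
  using (∈-∃++; ∈-++⁺ˡ; ∈-++⁺ʳ; ∈-++⁻; ∈-map⁺; ∈-map⁻; ∈-upTo⁺; ∈-upTo⁻)
open import Data.List.Relation.Binary.Permutation.Propositional using (_↭_; ↭-refl; ↭-sym; prep; swap)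
open import Data.List.Relation.Binary.Permutation.Propositional.Properties using (All-resp-↭; ↭-length; shift; ∷↭∷ʳ)
open import Data.List.Relation.Unary.All as All using (All; []; _∷_)
import Data.List.Relation.Unary.All.Properties as All
open import Data.List.Relation.Unary.AllPairs as AllPairs using (AllPairs; []; _∷_)
import Data.List.Relation.Unary.AllPairs.Properties as AllPairs
open import Data.List.Relation.Unary.Any using (here; there)
open import Data.Nat using (ℕ; zero; suc; _+_; _*_; _∸_; _<_; _≤_; z≤n; s≤s; s≤s⁻¹; s<s⁻¹; _≤?_; _<?_; _≟_; NonZero)
open import Data.Nat.DivMod
  using (_/_; _%_; m≡m%n+[m/n]*n; m%n<n; n%1≡0; [m+kn]%n≡m%n; m<n⇒m%n≡m; m<n⇒m/n≡0; m*n/n≡m; +-distrib-/-∣ʳ)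
open import Data.Nat.Divisibility using (n∣m*n)
open import Data.Nat.Induction using (<-rec)
open import Data.Nat.ListAction using (sum)
open import Data.Nat.ListAction.Properties using (sum-++; sum-↭)
open import Data.Nat.Properties
open import Data.List.Membership.DecPropositional _≟_ using (_∈?_)
open import Algebra.Properties.CommutativeSemigroup +-commutativeSemigroup using (x∙yz≈y∙xz; xy∙z≈xz∙y)
open import Data.Product using (Σ; _×_; _,_; proj₁; proj₂)
open import Data.Sum using (_⊎_; inj₁; inj₂)
open import Data.Unit using (⊤; tt)
open import Function using (_∘_)
open import Relation.Binary.PropositionalEquality hiding ([_])
open import Relation.Nullary using (¬_; yes; no)

open ≤-Reasoning

∈⇒↭∷ : ∀ {v : ℕ} {M} → v ∈ M → Σ (List ℕ) λ M' → M ↭ v ∷ M'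
∈⇒↭∷ {v} v∈M with ∈-∃++ v∈M
... | ys , zs , refl = ys ++ zs , shift v ys zs

0<sum⇒nonempty : ∀ M → 0 < sum M → Σ ℕ (_∈ M)
0<sum⇒nonempty (v ∷ _) _ = v , here refl

∈⇒≤sum : ∀ {v} M → v ∈ M → v ≤ sum M
∈⇒≤sum (_ ∷ M) (here refl) = m≤m+n _ (sum M)
∈⇒≤sum (u ∷ M) (there p) = ≤-trans (∈⇒≤sum M p) (m≤n+m (sum M) u)

∈⇒≤largest : ∀ {v} xs → v ∈ xs → v ≤ largest xs
∈⇒≤largest (u ∷ xs) (here refl) = m≤m⊔n u _
∈⇒≤largest (u ∷ xs) (there p) = ≤-trans (∈⇒≤largest xs p) (m≤n⊔m u _)

prefixInWindow : ∀ {t d} a M → All (_≤ d) M → a < t → t ≤ a + sum M →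
  Σ (List ℕ) λ S → Σ (List ℕ) λ T → M ≡ S ++ T × t ≤ a + sum S × a + sum S < t + d
prefixInWindow a [] _ a<t t≤a+0 = ⊥-elim (<⇒≱ a<t (subst (_ ≤_) (+-identityʳ a) t≤a+0))
prefixInWindow {t} {d} a (u ∷ M) (u≤d ∷ M≤d) a<t t≤ with t ≤? a + u
... | yes t≤a+u = [ u ] , M , refl , subst (t ≤_) a+u≡ t≤a+u , subst (_< t + d) a+u≡ (+-mono-<-≤ a<t u≤d)
  where
  a+u≡ : a + u ≡ a + sum [ u ]
  a+u≡ = cong (a +_) (sym (+-identityʳ u))
... | no t≰a+u with prefixInWindow (a + u) M M≤d (≰⇒> t≰a+u) (subst (t ≤_) (sym (+-assoc a u _)) t≤)
...   | S , T , refl , t≤S , S<t+d = u ∷ S , T , refl , subst (t ≤_) (+-assoc a u _) t≤S , subst (_< t + d) (+-assoc a u _) S<t+d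

-- α is the greedy coefficient vector over the coins cs, given that the coins before cs
-- already contribute a.
GreedyFrom : ℕ → List ℕ → List ℕ → Set
GreedyFrom a []      []       = ⊤
GreedyFrom a (k ∷ α) (c ∷ cs) = a < c × GreedyFrom (a + k * c) α cs
GreedyFrom a _       _        = ⊥

greedyFrom-length : ∀ {a} α cs → GreedyFrom a α cs → length α ≡ length cs
greedyFrom-length []      []       _       = refl
greedyFrom-length (k ∷ α) (c ∷ cs) (_ , g) = cong suc (greedyFrom-length α cs g)

module _ {c} .{{_ : NonZero c}} where

  [r+q*c]%c≡r : ∀ {r} q → r < c → (r + q * c) % c ≡ r
  [r+q*c]%c≡r {r} q r<c = trans ([m+kn]%n≡m%n r q c) (m<n⇒m%n≡m r<c)

  [r+q*c]/c≡q : ∀ {r} q → r < c → (r + q * c) / c ≡ q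
  [r+q*c]/c≡q {r} q r<c = begin-equality
    (r + q * c) / c    ≡⟨ +-distrib-/-∣ʳ r (n∣m*n q) ⟩
    r / c + q * c / c  ≡⟨ cong₂ _+_ (m<n⇒m/n≡0 r<c) (m*n/n≡m q c) ⟩
    q                  ∎

divMod-unique : ∀ {c r r'} q q' → r < c → r' < c → r + q * c ≡ r' + q' * c → r ≡ r' × q ≡ q'
divMod-unique {suc c} q q' r<c r'<c eq =
  trans (sym ([r+q*c]%c≡r q r<c)) (trans (cong (_% suc c) eq) ([r+q*c]%c≡r q' r'<c)) ,
  trans (sym ([r+q*c]/c≡q q r<c)) (trans (cong (_/ suc c) eq) ([r+q*c]/c≡q q' r'<c))

greedyFrom-unique : ∀ cs {a a'} α α' → GreedyFrom a α cs → GreedyFrom a' α' cs →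
  a + value α cs ≡ a' + value α' cs → a ≡ a' × α ≡ α'
greedyFrom-unique [] {a} {a'} [] [] _ _ eq = trans (sym (+-identityʳ a)) (trans eq (+-identityʳ a')) , refl
greedyFrom-unique (c ∷ cs) {a} {a'} (k ∷ α) (k' ∷ α') (a<c , g) (a'<c , g') eq
  with greedyFrom-unique cs α α' g g' (trans (+-assoc a (k * c) _) (trans eq (sym (+-assoc a' (k' * c) _))))
... | a+kc≡a'+k'c , refl with divMod-unique k k' a<c a'<c a+kc≡a'+k'c
... | refl , refl = refl , refl

incrementAt : ∀ {v : ℕ} {cs} → v ∈ cs → List ℕ → List ℕ
incrementAt (here _)  (k ∷ α) = suc k ∷ α
incrementAt (there p) (k ∷ α) = k ∷ incrementAt p α
incrementAt _         []      = []

coinsAfter : ∀ {v : ℕ} {cs} → v ∈ cs → List ℕ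
coinsAfter (here {xs = cs} _) = cs
coinsAfter (there p)          = coinsAfter p

module _ {v : ℕ} where

  length-incrementAt : ∀ {cs} (p : v ∈ cs) α → length (incrementAt p α) ≡ length α
  length-incrementAt (here _)  (k ∷ α) = refl
  length-incrementAt (there p) (k ∷ α) = cong suc (length-incrementAt p α)
  length-incrementAt (here _)  []      = refl
  length-incrementAt (there p) []      = refl

  sum-incrementAt : ∀ {cs} (p : v ∈ cs) α → length α ≡ length cs → sum (incrementAt p α) ≡ suc (sum α)
  sum-incrementAt (here _)  (k ∷ α) _ = refl
  sum-incrementAt (there p) (k ∷ α) e = trans (cong (k +_) (sum-incrementAt p α (suc-injective e))) (+-suc k (sum α))

  value-incrementAt : ∀ {cs} (p : v ∈ cs) α → length α ≡ length cs → value (incrementAt p α) cs ≡ v + value α cs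
  value-incrementAt (here refl) (k ∷ α) _ = +-assoc v (k * v) _
  value-incrementAt {c ∷ cs} (there p) (k ∷ α) e = begin-equality
    k * c + value (incrementAt p α) cs  ≡⟨ cong (k * c +_) (value-incrementAt p α (suc-injective e)) ⟩
    k * c + (v + value α cs)            ≡⟨ x∙yz≈y∙xz (k * c) v _ ⟩
    v + (k * c + value α cs)            ∎

greedyFrom-raise : ∀ e {a} α cs → GreedyFrom a α cs → All (λ c → a + value α cs + e < c) cs →
  GreedyFrom (a + e) α cs
greedyFrom-raise e []      []       _         _          = tt
greedyFrom-raise e {a} (k ∷ α) (c ∷ cs) (_ , g) (lt ∷ lts) =
  ≤-<-trans (+-monoˡ-≤ e (m≤m+n a _)) lt ,
  subst (λ b → GreedyFrom b α cs) (xy∙z≈xz∙y a (k * c) e)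
    (greedyFrom-raise e α cs g (All.map (λ {c'} → subst (_< c') (cong (_+ e) (sym (+-assoc a (k * c) _)))) lts))

greedyFrom-incrementAt : ∀ {v a} α cs (p : v ∈ cs) → GreedyFrom a α cs →
  All (λ c → a + value α cs + v < c) (coinsAfter p) → GreedyFrom a (incrementAt p α) cs
greedyFrom-incrementAt {v} {a} (k ∷ α) (v ∷ cs) (here refl) (a<v , g) lts =
  a<v ,
  subst (λ b → GreedyFrom b α cs) (trans (+-assoc a (k * v) v) (cong (a +_) (+-comm (k * v) v)))
    (greedyFrom-raise v α cs g (All.map (λ {c'} → subst (_< c') (cong (_+ v) (sym (+-assoc a (k * v) _)))) lts))
greedyFrom-incrementAt {v} {a} (k ∷ α) (c ∷ cs) (there p) (a<c , g) lts =
  a<c ,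
  greedyFrom-incrementAt α cs p g (All.map (λ {c'} → subst (_< c') (cong (_+ v) (sym (+-assoc a (k * c) _)))) lts)

divideStep : ℕ → ℕ × List ℕ → ℕ × List ℕ
divideStep zero    (u , β) = u , 0 ∷ β
divideStep (suc c) (u , β) = u % suc c , u / suc c ∷ β

greedyDivide : List ℕ → ℕ → ℕ × List ℕ
greedyDivide []       y = y , []
greedyDivide (c ∷ cs) y = divideStep c (greedyDivide cs y)

greedyDivide-correct : ∀ cs y → All (0 <_) cs →
  GreedyFrom (proj₁ (greedyDivide cs y)) (proj₂ (greedyDivide cs y)) cs ×
  proj₁ (greedyDivide cs y) + value (proj₂ (greedyDivide cs y)) cs ≡ y
greedyDivide-correct []       y _ = tt , +-identityʳ y
greedyDivide-correct (suc c ∷ cs) y (s≤s z≤n ∷ ps) with greedyDivide cs y | greedyDivide-correct cs y ps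
... | u , β | g , eq =
  (m%n<n u (suc c) , subst (λ b → GreedyFrom b β cs) (m≡m%n+[m/n]*n u (suc c)) g) ,
  (begin-equality
    u % suc c + (u / suc c * suc c + value β cs)  ≡⟨ +-assoc (u % suc c) _ _ ⟨
    u % suc c + u / suc c * suc c + value β cs    ≡⟨ cong (_+ value β cs) (m≡m%n+[m/n]*n u (suc c)) ⟨
    u + value β cs                                ≡⟨ eq ⟩
    y                                             ∎)

greedyFrom⇒prefixBelow : ∀ {a} α cs → GreedyFrom a α cs → ∀ k (k<m : k < length cs) →
  a + value (take k α) (take k cs) < lookup cs (fromℕ< k<m)
greedyFrom⇒prefixBelow {a} (k ∷ α) (c ∷ cs) (a<c , _) zero _ = subst (_< c) (sym (+-identityʳ a)) a<c
greedyFrom⇒prefixBelow {a} (k ∷ α) (c ∷ cs) (_ , g) (suc i) (s≤s i<m) =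
  subst (_< lookup cs (fromℕ< i<m)) (+-assoc a (k * c) _) (greedyFrom⇒prefixBelow α cs g i i<m)

prefixBelow⇒greedyFrom : ∀ {a} α cs → length α ≡ length cs →
  (∀ k (k<m : k < length cs) → a + value (take k α) (take k cs) < lookup cs (fromℕ< k<m)) →
  GreedyFrom a α cs
prefixBelow⇒greedyFrom []      []       _ _     = tt
prefixBelow⇒greedyFrom {a} (k ∷ α) (c ∷ cs) e below =
  subst (_< c) (+-identityʳ a) (below zero (s≤s z≤n)) ,
  prefixBelow⇒greedyFrom α cs (suc-injective e)
    (λ i i<m → subst (_< lookup cs (fromℕ< i<m)) (sym (+-assoc a (k * c) _)) (below (suc i) (s≤s i<m)))

-- Representations are handled as lists of coins: α becomes α_i copies of each coin c_i.
coinList : List ℕ → List ℕ → List ℕ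
coinList (k ∷ α) (c ∷ cs) = replicate k c ++ coinList α cs
coinList _       _        = []

sum-replicate : ∀ k c → sum (replicate k c) ≡ k * c
sum-replicate zero    c = refl
sum-replicate (suc k) c = cong (c +_) (sum-replicate k c)

sum-coinList : ∀ α cs → sum (coinList α cs) ≡ value α cs
sum-coinList (k ∷ α) (c ∷ cs) = trans (sum-++ (replicate k c) _) (cong₂ _+_ (sum-replicate k c) (sum-coinList α cs))
sum-coinList []      []       = refl
sum-coinList []      (_ ∷ _)  = refl
sum-coinList (_ ∷ _) []       = refl

length-coinList : ∀ α cs → length α ≡ length cs → length (coinList α cs) ≡ sum α
length-coinList (k ∷ α) (c ∷ cs) e =
  trans (length-++ (replicate k c)) (cong₂ _+_ (length-replicate k) (length-coinList α cs (suc-injective e)))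
length-coinList []      []       _ = refl

coinList-⊆ : ∀ α cs → All (_∈ cs) (coinList α cs)
coinList-⊆ (k ∷ α) (c ∷ cs) = All.++⁺ (All.replicate⁺ k (here refl)) (All.map there (coinList-⊆ α cs))
coinList-⊆ []      []       = []
coinList-⊆ []      (_ ∷ _)  = []
coinList-⊆ (_ ∷ _) []       = []

coeffsOf : ∀ cs (M : List ℕ) → All (_∈ cs) M → List ℕ
coeffsOf cs []      _        = replicate (length cs) 0
coeffsOf cs (v ∷ M) (p ∷ ps) = incrementAt p (coeffsOf cs M ps)

length-coeffsOf : ∀ cs M ps → length (coeffsOf cs M ps) ≡ length cs
length-coeffsOf cs []      _        = length-replicate (length cs)
length-coeffsOf cs (v ∷ M) (p ∷ ps) = trans (length-incrementAt p _) (length-coeffsOf cs M ps)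

value-coeffsOf : ∀ cs M ps → value (coeffsOf cs M ps) cs ≡ sum M
value-coeffsOf cs      (v ∷ M) (p ∷ ps) =
  trans (value-incrementAt p _ (length-coeffsOf cs M ps)) (cong (v +_) (value-coeffsOf cs M ps))
value-coeffsOf []       [] _ = refl
value-coeffsOf (c ∷ cs) [] _ = value-coeffsOf cs [] []

sum-coeffsOf : ∀ cs M ps → sum (coeffsOf cs M ps) ≡ length M
sum-coeffsOf cs       (v ∷ M) (p ∷ ps) =
  trans (sum-incrementAt p _ (length-coeffsOf cs M ps)) (cong suc (sum-coeffsOf cs M ps))
sum-coeffsOf []       [] _ = refl
sum-coeffsOf (c ∷ cs) [] _ = sum-coeffsOf cs [] []

lastAtMost : ∀ {y c cs} → AllPairs _<_ (c ∷ cs) → c ≤ y →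
  Σ ℕ λ h → Σ (h ∈ c ∷ cs) λ p → h ≤ y × All (y <_) (coinsAfter p)
lastAtMost {cs = []}      _         c≤y = _ , here refl , c≤y , []
lastAtMost {y} {cs = c' ∷ _} (_ ∷ inc) c≤y with c' ≤? y
... | yes c'≤y = let h , p , h≤y , above = lastAtMost inc c'≤y in h , there p , h≤y , above
... | no  c'≰y = _ , here refl , c≤y , ≰⇒> c'≰y ∷ All.map (<-trans (≰⇒> c'≰y)) (AllPairs.head inc)

lastAtMost-maximal : ∀ {y h h' cs} → AllPairs _<_ cs → (p : h ∈ cs) → All (y <_) (coinsAfter p) →
  h' ∈ cs → h' ≤ y → h' ≤ h
lastAtMost-maximal _          (here refl) _     (here refl) _    = ≤-refl
lastAtMost-maximal _          (here refl) above (there q)   h'≤y = ⊥-elim (<⇒≱ (All.lookup above q) h'≤y)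
lastAtMost-maximal (hd ∷ _)   (there p)   _     (here refl) _    = <⇒≤ (All.lookup hd p)
lastAtMost-maximal (_ ∷ inc)  (there p)   above (there q)   h'≤y = lastAtMost-maximal inc p above q h'≤y

sum≡0⇒[] : ∀ M → All (0 <_) M → sum M ≡ 0 → M ≡ []
sum≡0⇒[] []      _          _  = refl
sum≡0⇒[] (v ∷ M) (0<v ∷ _) eq = ⊥-elim (<⇒≱ 0<v (subst (v ≤_) eq (m≤m+n v (sum M))))

module CoinSystem (ds : List ℕ) (increasing : AllPairs _<_ (1 ∷ ds)) where

  cs : List ℕ
  cs = 1 ∷ ds

  Coin : ℕ → Set
  Coin v = v ∈ cs

  coin-positive : ∀ {v} → Coin v → 0 < v
  coin-positive (here refl) = s≤s z≤n
  coin-positive (there p)   = <-trans (s≤s z≤n) (All.lookup (AllPairs.head increasing) p)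

  greedyCoeffs : ℕ → List ℕ
  greedyCoeffs y = proj₂ (greedyDivide cs y)

  private
    remainder≡0 : ∀ y → proj₁ (greedyDivide cs y) ≡ 0
    remainder≡0 y = n%1≡0 (proj₁ (greedyDivide ds y))

    coins-positive : All (0 <_) cs
    coins-positive = All.tabulate coin-positive

  greedyCoeffs-greedy : ∀ y → GreedyFrom 0 (greedyCoeffs y) cs
  greedyCoeffs-greedy y = subst (λ a → GreedyFrom a (greedyCoeffs y) cs) (remainder≡0 y)
    (proj₁ (greedyDivide-correct cs y coins-positive))

  value-greedyCoeffs : ∀ y → value (greedyCoeffs y) cs ≡ y
  value-greedyCoeffs y = subst (λ a → a + value (greedyCoeffs y) cs ≡ y) (remainder≡0 y)
    (proj₂ (greedyDivide-correct cs y coins-positive))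

  length-greedyCoeffs : ∀ y → length (greedyCoeffs y) ≡ length cs
  length-greedyCoeffs y = greedyFrom-length (greedyCoeffs y) cs (greedyCoeffs-greedy y)

  greedySize : ℕ → ℕ
  greedySize y = sum (greedyCoeffs y)

  greedyRep : ∀ y → Rep cs y
  greedyRep y = rep (greedyCoeffs y) (length-greedyCoeffs y) (value-greedyCoeffs y)

  greedyRep-isGreedy : ∀ y → IsGreedy (greedyRep y)
  greedyRep-isGreedy y k k<m _ = greedyFrom⇒prefixBelow (greedyCoeffs y) cs (greedyCoeffs-greedy y) k k<m

  isGreedy⇒greedyFrom : ∀ {y} (g : Rep cs y) → IsGreedy g → GreedyFrom 0 (coeffs g) cs
  isGreedy⇒greedyFrom g isGreedy = prefixBelow⇒greedyFrom (coeffs g) cs (len g) below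
    where
    below : ∀ k (k<m : k < length cs) → value (take k (coeffs g)) (take k cs) < lookup cs (fromℕ< k<m)
    below zero    _   = s≤s z≤n
    below (suc k) k<m = isGreedy (suc k) k<m (s≤s z≤n)

  size-isGreedy : ∀ {y} (g : Rep cs y) → IsGreedy g → size g ≡ greedySize y
  size-isGreedy {y} g isGreedy = cong sum (proj₂
    (greedyFrom-unique cs (coeffs g) (greedyCoeffs y) (isGreedy⇒greedyFrom g isGreedy) (greedyCoeffs-greedy y)
      (trans (val g) (sym (value-greedyCoeffs y)))))

  greedyCoins : ℕ → List ℕ
  greedyCoins y = coinList (greedyCoeffs y) cs

  greedyCoins-coins : ∀ y → All Coin (greedyCoins y)
  greedyCoins-coins y = coinList-⊆ (greedyCoeffs y) cs

  sum-greedyCoins : ∀ y → sum (greedyCoins y) ≡ y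
  sum-greedyCoins y = trans (sum-coinList (greedyCoeffs y) cs) (value-greedyCoeffs y)

  length-greedyCoins : ∀ y → length (greedyCoins y) ≡ greedySize y
  length-greedyCoins y = length-coinList (greedyCoeffs y) cs (length-greedyCoeffs y)

  BeatsGreedy : ℕ → List ℕ → Set
  BeatsGreedy y M = All Coin M × sum M ≡ y × length M < greedySize y

  counterexample⇒beatsGreedy : ∀ {y} → Counterexample cs y → Σ (List ℕ) (BeatsGreedy y)
  counterexample⇒beatsGreedy (g , isGreedy , r , r<g) =
    coinList (coeffs r) cs ,
    coinList-⊆ (coeffs r) cs ,
    trans (sum-coinList (coeffs r) cs) (val r) ,
    subst₂ _<_ (sym (length-coinList (coeffs r) cs (len r))) (size-isGreedy g isGreedy) r<g

  beatsGreedy⇒counterexample : ∀ {y} M → BeatsGreedy y M → Counterexample cs y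
  beatsGreedy⇒counterexample {y} M (coins , sum≡y , shorter) =
    greedyRep y , greedyRep-isGreedy y ,
    rep (coeffsOf cs M coins) (length-coeffsOf cs M coins) (trans (value-coeffsOf cs M coins) sum≡y) ,
    subst (_< greedySize y) (sym (sum-coeffsOf cs M coins)) shorter

  greedy-optimal : ∀ {y} → ¬ Counterexample cs y → ∀ M → All Coin M → sum M ≡ y → greedySize y ≤ length M
  greedy-optimal ¬ce M coins sum≡y = ≮⇒≥ λ shorter → ¬ce (beatsGreedy⇒counterexample M (coins , sum≡y , shorter))

  record LargestCoin≤ (y : ℕ) : Set where
    field
      coin    : ℕ
      coin∈   : Coin coin
      coin≤y  : coin ≤ y
      maximal : ∀ {h} → Coin h → h ≤ y → h ≤ coin

  largestCoin≤ : ∀ {y} → 1 ≤ y → LargestCoin≤ y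
  largestCoin≤ 1≤y =
    let h , p , h≤y , above = lastAtMost increasing 1≤y
    in record { coin = h ; coin∈ = p ; coin≤y = h≤y ; maximal = lastAtMost-maximal increasing p above }

  -- Adding the coin h to the greedy vector of y ∸ h keeps it greedy, so by uniqueness it is
  -- the greedy vector of y.
  greedySize-stepAt : ∀ {y h} (p : Coin h) → h ≤ y → All (y <_) (coinsAfter p) →
    greedySize y ≡ suc (greedySize (y ∸ h))
  greedySize-stepAt {y} {h} p h≤y above = begin-equality
    greedySize y              ≡⟨ cong sum (proj₂ (greedyFrom-unique cs α (greedyCoeffs y) α-greedy (greedyCoeffs-greedy y) α-value)) ⟨
    sum α                     ≡⟨ sum-incrementAt p β (length-greedyCoeffs (y ∸ h)) ⟩
    suc (greedySize (y ∸ h))  ∎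
    where
    β = greedyCoeffs (y ∸ h)
    α = incrementAt p β
    β-value : value β cs + h ≡ y
    β-value = trans (cong (_+ h) (value-greedyCoeffs (y ∸ h))) (m∸n+n≡m h≤y)
    α-greedy : GreedyFrom 0 α cs
    α-greedy = greedyFrom-incrementAt β cs p (greedyCoeffs-greedy (y ∸ h))
                 (All.map (λ {c} → subst (_< c) (sym β-value)) above)
    α-value : value α cs ≡ value (greedyCoeffs y) cs
    α-value = begin-equality
      value α cs                 ≡⟨ value-incrementAt p β (length-greedyCoeffs (y ∸ h)) ⟩
      h + value β cs             ≡⟨ cong (h +_) (value-greedyCoeffs (y ∸ h)) ⟩
      h + (y ∸ h)                ≡⟨ m+[n∸m]≡n h≤y ⟩
      y                          ≡⟨ value-greedyCoeffs y ⟨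
      value (greedyCoeffs y) cs  ∎

  greedySize-step : ∀ {y} (G : LargestCoin≤ y) → greedySize y ≡ suc (greedySize (y ∸ LargestCoin≤.coin G))
  greedySize-step {y} G =
    let h , p , h≤y , above = lastAtMost increasing (≤-trans (coin-positive coin∈) coin≤y)
    in subst (λ g → greedySize y ≡ suc (greedySize (y ∸ g)))
         (≤-antisym (maximal p h≤y) (lastAtMost-maximal increasing p above coin∈ coin≤y))
         (greedySize-stepAt p h≤y above)
    where open LargestCoin≤ G

  greedySize-0 : greedySize 0 ≡ 0
  greedySize-0 = begin-equality
    greedySize 0            ≡⟨ length-greedyCoins 0 ⟨
    length (greedyCoins 0)  ≡⟨ cong length (sum≡0⇒[] (greedyCoins 0) (All.map coin-positive (greedyCoins-coins 0)) (sum-greedyCoins 0)) ⟩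
    0                       ∎

  greedySize-positive : ∀ {y} → 1 ≤ y → 1 ≤ greedySize y
  greedySize-positive 1≤y = subst (1 ≤_) (sym (greedySize-step (largestCoin≤ 1≤y))) (s≤s z≤n)

  greedySize≥2 : ∀ {y} → 1 ≤ y → ¬ Coin y → 2 ≤ greedySize y
  greedySize≥2 {y} 1≤y ¬coin = subst (2 ≤_) (sym (greedySize-step G)) (s≤s (greedySize-positive (m<n⇒0<n∸m coin<y)))
    where
    G = largestCoin≤ 1≤y
    open LargestCoin≤ G
    coin<y : coin < y
    coin<y = ≤∧≢⇒< coin≤y λ coin≡y → ¬coin (subst Coin coin≡y coin∈)

  beatsGreedy-↭ : ∀ {y M N} → M ↭ N → BeatsGreedy y M → BeatsGreedy y N
  beatsGreedy-↭ M↭N (coins , sum≡y , shorter) =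
    All-resp-↭ M↭N coins , trans (sym (sum-↭ M↭N)) sum≡y , subst (_< _) (↭-length M↭N) shorter

  beatsGreedy-replace : ∀ {y} S N T → BeatsGreedy y (S ++ T) →
    All Coin N → sum N ≡ sum S → length N ≤ length S → BeatsGreedy y (N ++ T)
  beatsGreedy-replace {y} S N T (coins , sum≡y , shorter) N-coins sumN≡sumS N≤S =
    All.++⁺ N-coins (All.++⁻ʳ S coins) ,
    (begin-equality
      sum (N ++ T)       ≡⟨ sum-++ N T ⟩
      sum N + sum T      ≡⟨ cong (_+ sum T) sumN≡sumS ⟩
      sum S + sum T      ≡⟨ sum-++ S T ⟨
      sum (S ++ T)       ≡⟨ sum≡y ⟩
      y                  ∎) ,
    ≤-<-trans (≤-reflexive (length-++ N))
      (≤-<-trans (+-monoˡ-≤ (length T) N≤S) (subst (_< greedySize y) (length-++ S) shorter))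

  greedyCoinsVia : ∀ {s} → LargestCoin≤ s → List ℕ
  greedyCoinsVia {s} G = coin ∷ greedyCoins (s ∸ coin)
    where open LargestCoin≤ G

  beatsGreedy-regreedy : ∀ {y} S T → BeatsGreedy y (S ++ T) → ¬ Counterexample cs (sum S) →
    (G : LargestCoin≤ (sum S)) → BeatsGreedy y (greedyCoinsVia G ++ T)
  beatsGreedy-regreedy S T beats ¬ce G =
    beatsGreedy-replace S (greedyCoinsVia G) T beats
      (coin∈ ∷ greedyCoins-coins (sum S ∸ coin))
      (trans (cong (coin +_) (sum-greedyCoins (sum S ∸ coin))) (m+[n∸m]≡n coin≤y))
      (subst (_≤ length S) (trans (greedySize-step G) (cong suc (sym (length-greedyCoins (sum S ∸ coin)))))
        (greedy-optimal ¬ce S (All.++⁻ˡ S (proj₁ beats)) refl))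
    where open LargestCoin≤ G

  beatsGreedy-pick : ∀ {y M a} → BeatsGreedy y M → a ∈ M → Σ (List ℕ) λ R → BeatsGreedy y (a ∷ R)
  beatsGreedy-pick beats a∈M = let R , M↭a∷R = ∈⇒↭∷ a∈M in R , beatsGreedy-↭ M↭a∷R beats

  beatsGreedy-regreedyTail : ∀ {y} a S → BeatsGreedy y (a ∷ S) → ¬ Counterexample cs (sum S) →
    (G : LargestCoin≤ (sum S)) → BeatsGreedy y (a ∷ greedyCoinsVia G)
  beatsGreedy-regreedyTail a S beats ¬ce G =
    beatsGreedy-↭ (↭-sym (∷↭∷ʳ a (greedyCoinsVia G)))
      (beatsGreedy-regreedy S [ a ] (beatsGreedy-↭ (∷↭∷ʳ a S) beats) ¬ce G)

  beatsGreedy-dropLargest : ∀ {y} (G : LargestCoin≤ y) R → BeatsGreedy y (LargestCoin≤.coin G ∷ R) →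
    BeatsGreedy (y ∸ LargestCoin≤.coin G) R
  beatsGreedy-dropLargest {y} G R (_ ∷ coins , sum≡y , shorter) =
    coins ,
    trans (sym (m+n∸m≡n coin (sum R))) (cong (_∸ coin) sum≡y) ,
    s<s⁻¹ (subst (suc (length R) <_) (greedySize-step G) shorter)
    where open LargestCoin≤ G

module TopCoin (ds : List ℕ) (increasing : AllPairs _<_ (1 ∷ ds)) (cm L : ℕ)
  (cm∈ : cm ∈ 1 ∷ ds) (≤cm : ∀ {a} → a ∈ 1 ∷ ds → a ≤ cm) (cm<L : cm < L) where

  module S₂ = CoinSystem ds increasing
  module S₃ = CoinSystem (ds ∷ʳ L)
    (AllPairs.++⁺ increasing ([] ∷ []) (All.tabulate λ a∈ → ≤-<-trans (≤cm a∈) cm<L ∷ []))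

  L∈₃ : S₃.Coin L
  L∈₃ = ∈-++⁺ʳ (1 ∷ ds) (here refl)

  ∈₂⇒∈₃ : ∀ {a} → S₂.Coin a → S₃.Coin a
  ∈₂⇒∈₃ = ∈-++⁺ˡ

  ∈₃⇒∈₂ : ∀ {a} → S₃.Coin a → a ≢ L → S₂.Coin a
  ∈₃⇒∈₂ a∈ a≢L with ∈-++⁻ (1 ∷ ds) a∈
  ... | inj₁ a∈₂          = a∈₂
  ... | inj₂ (here a≡L)   = ⊥-elim (a≢L a≡L)

  coin≤cm : ∀ {a} → S₃.Coin a → a ≢ L → a ≤ cm
  coin≤cm a∈ a≢L = ≤cm (∈₃⇒∈₂ a∈ a≢L)

  ∈₃⇒≤L : ∀ {a} → S₃.Coin a → a ≤ L
  ∈₃⇒≤L {a} a∈ with a ≟ L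
  ... | yes a≡L = ≤-reflexive a≡L
  ... | no  a≢L = <⇒≤ (≤-<-trans (coin≤cm a∈ a≢L) cm<L)

  gap : ℕ
  gap = L ∸ cm

  L≡cm+gap : L ≡ cm + gap
  L≡cm+gap = sym (m+[n∸m]≡n (<⇒≤ cm<L))

  L-largest : ∀ {y} → L ≤ y → S₃.LargestCoin≤ y
  L-largest L≤y = record { coin = L ; coin∈ = L∈₃ ; coin≤y = L≤y ; maximal = λ a∈ _ → ∈₃⇒≤L a∈ }

  cm-largest₂ : ∀ {y} → cm ≤ y → S₂.LargestCoin≤ y
  cm-largest₂ cm≤y = record { coin = cm ; coin∈ = cm∈ ; coin≤y = cm≤y ; maximal = λ a∈ _ → ≤cm a∈ }

  cm-largest₃ : ∀ {y} → cm ≤ y → y < L → S₃.LargestCoin≤ y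
  cm-largest₃ cm≤y y<L = record
    { coin = cm ; coin∈ = ∈₂⇒∈₃ cm∈ ; coin≤y = cm≤y
    ; maximal = λ a∈ a≤y → ≤cm (∈₃⇒∈₂ a∈ λ a≡L → <⇒≢ (≤-<-trans a≤y y<L) a≡L) }

  greedySize₃≡greedySize₂ : ∀ y → y < L → S₃.greedySize y ≡ S₂.greedySize y
  greedySize₃≡greedySize₂ = <-rec _ step
    where
    step : ∀ y → (∀ {z} → z < y → z < L → S₃.greedySize z ≡ S₂.greedySize z) →
      y < L → S₃.greedySize y ≡ S₂.greedySize y
    step zero    _  _   = trans S₃.greedySize-0 (sym S₂.greedySize-0)
    step (suc y) ih y<L = begin-equality
      S₃.greedySize (suc y)               ≡⟨ S₃.greedySize-step G₃ ⟩
      suc (S₃.greedySize (suc y ∸ coin))  ≡⟨ cong suc (ih (∸-monoʳ-< (S₃.coin-positive coin∈) coin≤y)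
                                                         (≤-<-trans (m∸n≤m (suc y) coin) y<L)) ⟩
      suc (S₂.greedySize (suc y ∸ coin))  ≡⟨ S₂.greedySize-step G₂ ⟨
      S₂.greedySize (suc y)               ∎
      where
      G₃ = S₃.largestCoin≤ (s≤s z≤n)
      open S₃.LargestCoin≤ G₃
      G₂ : S₂.LargestCoin≤ (suc y)
      G₂ = record
        { coin = coin ; coin∈ = ∈₃⇒∈₂ coin∈ (λ coin≡L → <⇒≢ (≤-<-trans coin≤y y<L) coin≡L) ; coin≤y = coin≤y
        ; maximal = λ a∈ → maximal (∈₂⇒∈₃ a∈) }

  -- Below L both systems agree; above, regreedying all coins but one of a short list for y puts
  -- cm into it (as L ≥ 2 cm), and dropping cm gives a smaller counterexample y ∸ cm.
  cm≤gap⇒canonical₂ : cm ≤ gap → Tight S₃.cs → Canonical S₂.cs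
  cm≤gap⇒canonical₂ cm≤gap tight₃ = <-rec _ noCounterexample
    where
    noCounterexample : ∀ y → (∀ {z} → z < y → ¬ Counterexample S₂.cs z) → ¬ Counterexample S₂.cs y
    noCounterexample y ih ce with S₂.counterexample⇒beatsGreedy ce | y <? L
    ... | M , coins , sum≡y , shorter | yes y<L =
      tight₃ y (<-≤-trans y<L (∈⇒≤largest S₃.cs L∈₃)) (S₃.beatsGreedy⇒counterexample M
        (All.map ∈₂⇒∈₃ coins , sum≡y , subst (length M <_) (sym (greedySize₃≡greedySize₂ y y<L)) shorter))
    ... | [] , _ , sum≡y , _ | no y≮L = <⇒≱ (≤-<-trans z≤n cm<L) (subst (L ≤_) (sym sum≡y) (≮⇒≥ y≮L))
    ... | a ∷ M , beats@(a∈ ∷ _ , sum≡y , _) | no y≮L =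
      ih (∸-monoʳ-< (S₂.coin-positive cm∈) cm≤y)
        (S₂.beatsGreedy⇒counterexample _ (S₂.beatsGreedy-dropLargest (cm-largest₂ cm≤y) _
          (S₂.beatsGreedy-↭ (swap a cm ↭-refl)
            (S₂.beatsGreedy-regreedyTail a M beats (ih sumM<y) (cm-largest₂ cm≤sumM)))))
      where
      cm≤y : cm ≤ y
      cm≤y = ≤-trans (<⇒≤ cm<L) (≮⇒≥ y≮L)
      sumM<y : sum M < y
      sumM<y = subst (sum M <_) sum≡y (+-monoˡ-≤ (sum M) (S₂.coin-positive a∈))
      cm≤sumM : cm ≤ sum M
      cm≤sumM = ≤-trans cm≤gap (+-cancelˡ-≤ cm gap (sum M) (begin
        cm + gap   ≡⟨ L≡cm+gap ⟨
        L          ≤⟨ ≮⇒≥ y≮L ⟩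
        y          ≡⟨ sum≡y ⟨
        a + sum M  ≤⟨ +-monoˡ-≤ (sum M) (≤cm a∈) ⟩
        cm + sum M ∎))

  NoCounterexampleCmPlusCoin : Set
  NoCounterexampleCmPlusCoin = ∀ {a} → a ∈ ds → L < cm + a → ¬ Counterexample S₃.cs (cm + a)

  0<gap : 0 < gap
  0<gap = m<n⇒0<n∸m cm<L

  -- Otherwise cm + a = L + (a ∸ gap) would be a counterexample: two coins, against at least
  -- three greedily since a ∸ gap is not a coin.
  coin∸gap : NoCounterexampleCmPlusCoin → ∀ {a} → S₃.Coin a → a ≢ L → gap < a → S₃.Coin (a ∸ gap)
  coin∸gap noCounterexample {a} a∈ a≢L gap<a with (a ∸ gap) ∈? S₃.cs | ∈₃⇒∈₂ a∈ a≢L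
  ... | yes a∸gap∈ | _         = a∸gap∈
  ... | no  _      | here refl = ⊥-elim (<⇒≱ gap<a 0<gap)
  ... | no  a∸gap∉ | there a∈ds = ⊥-elim (noCounterexample a∈ds L<cm+a
          (S₃.beatsGreedy⇒counterexample (cm ∷ a ∷ [])
            (∈₂⇒∈₃ cm∈ ∷ a∈ ∷ [] , cong (cm +_) (+-identityʳ a) , greedy≥3)))
    where
    L<cm+a : L < cm + a
    L<cm+a = subst (_< cm + a) (sym L≡cm+gap) (+-monoʳ-< cm gap<a)
    cm+a∸L≡a∸gap : cm + a ∸ L ≡ a ∸ gap
    cm+a∸L≡a∸gap = trans (cong (cm + a ∸_) L≡cm+gap) ([m+n]∸[m+o]≡n∸o cm a gap)
    greedy≥3 : 2 < S₃.greedySize (cm + a)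
    greedy≥3 = subst (2 <_)
      (sym (trans (S₃.greedySize-step (L-largest (<⇒≤ L<cm+a))) (cong (suc ∘ S₃.greedySize) cm+a∸L≡a∸gap)))
      (s≤s (S₃.greedySize≥2 (m<n⇒0<n∸m gap<a) a∸gap∉))

  module MinimalCounterexample
    (gap<cm : gap < cm)
    (noCounterexample : NoCounterexampleCmPlusCoin)
    (x : ℕ) (ce : Counterexample S₃.cs x) (L≤x : L ≤ x) (minimal : ∀ y → y < x → ¬ Counterexample S₃.cs y)
    where

    open S₃

    Short : List ℕ → Set
    Short = BeatsGreedy x

    r : ℕ
    r = x ∸ L

    x≡L+r : x ≡ L + r
    x≡L+r = sym (m+[n∸m]≡n L≤x)

    ¬beats-below : ∀ {y M} → y < x → ¬ BeatsGreedy y M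
    ¬beats-below y<x beats = minimal _ y<x (beatsGreedy⇒counterexample _ beats)

    L∉short : ∀ {M} → Short M → L ∉ M
    L∉short short L∈M =
      let R , short′ = beatsGreedy-pick short L∈M
      in ¬beats-below (∸-monoʳ-< (coin-positive L∈₃) L≤x) (beatsGreedy-dropLargest (L-largest L≤x) R short′)

    short-coin≢L : ∀ {M a} → Short M → a ∈ M → a ≢ L
    short-coin≢L short a∈M a≡L = L∉short short (subst (_∈ _) a≡L a∈M)

    short-block≥L : ∀ S T → Short (S ++ T) → sum S < x → ¬ L ≤ sum S
    short-block≥L S T short S<x L≤S =
      L∉short (beatsGreedy-regreedy S T short (minimal _ S<x) (L-largest L≤S)) (here refl)

    -- Otherwise the other coins sum to at least L and could be regreedied into a list containing L.
    short-r<coin : ∀ {M a} → Short M → a ∈ M → r < a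
    short-r<coin {a = a} short a∈M with r <? a | beatsGreedy-pick short a∈M
    ... | yes r<a | _ = r<a
    ... | no  r≮a | R , short′@(a∈ ∷ _ , a+R≡x , _) =
      ⊥-elim (short-block≥L R [ a ] (beatsGreedy-↭ (∷↭∷ʳ a R) short′)
        (subst (sum R <_) a+R≡x (+-monoˡ-≤ (sum R) (coin-positive a∈)))
        (+-cancelʳ-≤ r L (sum R) (begin
          L + r      ≡⟨ x≡L+r ⟨
          x          ≡⟨ a+R≡x ⟨
          a + sum R  ≤⟨ +-monoˡ-≤ (sum R) (≮⇒≥ r≮a) ⟩
          r + sum R  ≡⟨ +-comm r (sum R) ⟩
          sum R + r  ∎)))

    -- cm + b = L + (b ∸ gap) would give an equally short list containing L.
    short-cm∷⇒coins≤gap : ∀ {R b} → Short (cm ∷ R) → b ∈ R → ¬ gap < b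
    short-cm∷⇒coins≤gap {b = b} short@(_ ∷ R-coins , _) b∈R gap<b =
      let R′ , R↭b∷R′ = ∈⇒↭∷ b∈R
      in L∉short
           (beatsGreedy-replace (cm ∷ b ∷ []) (L ∷ (b ∸ gap) ∷ []) R′ (beatsGreedy-↭ (prep cm R↭b∷R′) short)
             (L∈₃ ∷ coin∸gap noCounterexample (All.lookup R-coins b∈R) (short-coin≢L short (there b∈R)) gap<b ∷ [])
             L+[b∸gap]≡cm+b ≤-refl)
           (here refl)
      where
      L+[b∸gap]≡cm+b : sum (L ∷ (b ∸ gap) ∷ []) ≡ sum (cm ∷ b ∷ [])
      L+[b∸gap]≡cm+b = begin-equality
        L + (b ∸ gap + 0)      ≡⟨ cong (L +_) (+-identityʳ (b ∸ gap)) ⟩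
        L + (b ∸ gap)          ≡⟨ cong (_+ (b ∸ gap)) L≡cm+gap ⟩
        cm + gap + (b ∸ gap)   ≡⟨ +-assoc cm gap (b ∸ gap) ⟩
        cm + (gap + (b ∸ gap)) ≡⟨ cong (cm +_) (m+[n∸m]≡n (<⇒≤ gap<b)) ⟩
        cm + b                 ≡⟨ cong (cm +_) (+-identityʳ b) ⟨
        cm + (b + 0)           ∎

    O : List ℕ
    O = proj₁ (counterexample⇒beatsGreedy ce)

    O-short : Short O
    O-short = proj₂ (counterexample⇒beatsGreedy ce)

    -- Trading a for a ∸ gap gives a list for x ∸ gap = cm + r whose greedy representation (cm,
    -- then that of r) is as long as that of x (L, then that of r).
    r<gap⇒short-coins≤gap : r < gap → ∀ {M a} → Short M → a ∈ M → ¬ gap < a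
    r<gap⇒short-coins≤gap r<gap {a = a} short a∈M gap<a with beatsGreedy-pick short a∈M
    ... | R , (a∈ ∷ R-coins , a+R≡x , shorter) =
      ¬beats-below cm+r<x
        (coin∸gap noCounterexample a∈ (short-coin≢L short a∈M) gap<a ∷ R-coins ,
         [a∸gap]+R≡cm+r ,
         subst (suc (length R) <_) greedy-x≡greedy-cm+r shorter)
      where
      x≡gap+[cm+r] : x ≡ gap + (cm + r)
      x≡gap+[cm+r] = begin-equality
        x               ≡⟨ x≡L+r ⟩
        L + r           ≡⟨ cong (_+ r) L≡cm+gap ⟩
        cm + gap + r    ≡⟨ cong (_+ r) (+-comm cm gap) ⟩
        gap + cm + r    ≡⟨ +-assoc gap cm r ⟩
        gap + (cm + r)  ∎
      cm+r<x : cm + r < x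
      cm+r<x = subst (cm + r <_) (sym x≡gap+[cm+r]) (m<n+m (cm + r) 0<gap)
      cm+r<L : cm + r < L
      cm+r<L = subst (cm + r <_) (sym L≡cm+gap) (+-monoʳ-< cm r<gap)
      [a∸gap]+R≡cm+r : a ∸ gap + sum R ≡ cm + r
      [a∸gap]+R≡cm+r = +-cancelˡ-≡ gap _ _ (begin-equality
        gap + (a ∸ gap + sum R)  ≡⟨ +-assoc gap (a ∸ gap) (sum R) ⟨
        gap + (a ∸ gap) + sum R  ≡⟨ cong (_+ sum R) (m+[n∸m]≡n (<⇒≤ gap<a)) ⟩
        a + sum R                ≡⟨ a+R≡x ⟩
        x                        ≡⟨ x≡gap+[cm+r] ⟩
        gap + (cm + r)           ∎)
      greedy-x≡greedy-cm+r : greedySize x ≡ greedySize (cm + r)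
      greedy-x≡greedy-cm+r = begin-equality
        greedySize x                     ≡⟨ greedySize-step (L-largest L≤x) ⟩
        suc (greedySize r)               ≡⟨ cong (suc ∘ greedySize) (m+n∸m≡n cm r) ⟨
        suc (greedySize (cm + r ∸ cm))   ≡⟨ greedySize-step (cm-largest₃ (m≤m+n cm r) cm+r<L) ⟨
        greedySize (cm + r)              ∎

    -- Unless some coin exceeds gap, a prefix of O sums into [cm, L) and regreedies to start with cm.
    r≮gap : ¬ r < gap
    r≮gap r<gap with All.all? (_≤? gap) O
    ... | no ¬all≤gap =
      let a , a∈O , a≰gap = find (All.¬All⇒Any¬ (_≤? gap) O ¬all≤gap)
      in r<gap⇒short-coins≤gap r<gap O-short a∈O (≰⇒> a≰gap)
    ... | yes all≤gap with prefixInWindow 0 O all≤gap (coin-positive (∈₂⇒∈₃ cm∈))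
                             (subst (cm ≤_) (sym (proj₁ (proj₂ O-short))) (≤-trans (<⇒≤ cm<L) L≤x))
    ...   | S , T , O≡S++T , cm≤S , S<cm+gap =
      r<gap⇒short-coins≤gap r<gap
        (beatsGreedy-regreedy S T (subst Short O≡S++T O-short) (minimal _ (<-≤-trans S<L L≤x)) (cm-largest₃ cm≤S S<L))
        (here refl) gap<cm
      where
      S<L : sum S < L
      S<L = subst (sum S <_) (sym L≡cm+gap) S<cm+gap

    -- Regreedying the block gives a list that contains L or starts with cm followed by a coin > r ≥ gap.
    gap≤r⇒¬short-block≥cm : gap ≤ r → ∀ S T {b} → Short (S ++ T) → b ∈ T → ¬ cm ≤ sum S
    gap≤r⇒¬short-block≥cm gap≤r S T {b} short@(coins , sum≡x , _) b∈T cm≤S with L ≤? sum S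
    ... | yes L≤S = short-block≥L S T short S<x L≤S
      where
      S<x : sum S < x
      S<x = begin-strict
        sum S          <⟨ m<m+n (sum S) (<-≤-trans (coin-positive (All.lookup (All.++⁻ʳ S coins) b∈T)) (∈⇒≤sum T b∈T)) ⟩
        sum S + sum T  ≡⟨ sum-++ S T ⟨
        sum (S ++ T)   ≡⟨ sum≡x ⟩
        x              ∎
    ... | no  L≰S = short-cm∷⇒coins≤gap
      (beatsGreedy-regreedy S T short (minimal _ (<-≤-trans (≰⇒> L≰S) L≤x)) (cm-largest₃ cm≤S (≰⇒> L≰S)))
      (∈-++⁺ʳ _ b∈T) (≤-<-trans gap≤r (short-r<coin short (∈-++⁺ʳ S b∈T)))

    -- Descend from cm through cm ∸ gap, cm ∸ 2 gap, … (all coins), falling back to the coin 1.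
    coinWithinGap : ∀ {s} → 1 ≤ s → s < cm + gap → Σ ℕ λ g → Coin g × g ≤ s × s < g + gap
    coinWithinGap {s} 1≤s s<cm+gap = <-rec P descend cm (∈₂⇒∈₃ cm∈) ≤-refl s<cm+gap
      where
      P : ℕ → Set
      P h = Coin h → h ≤ cm → s < h + gap → Σ ℕ λ g → Coin g × g ≤ s × s < g + gap
      descend : ∀ h → (∀ {h′} → h′ < h → P h′) → P h
      descend h ih h∈ h≤cm s<h+gap with h ≤? s | gap <? h
      ... | yes h≤s | _         = h , h∈ , h≤s , s<h+gap
      ... | no  h≰s | yes gap<h =
        ih (∸-monoʳ-< 0<gap (<⇒≤ gap<h))
           (coin∸gap noCounterexample h∈ (λ h≡L → <⇒≢ (≤-<-trans h≤cm cm<L) h≡L) gap<h)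
           (≤-trans (m∸n≤m h gap) h≤cm)
           (subst (s <_) (sym (m∸n+n≡m (<⇒≤ gap<h))) (≰⇒> h≰s))
      ... | no  h≰s | no  gap≮h = 1 , here refl , 1≤s , s≤s (<⇒≤ (<-≤-trans (≰⇒> h≰s) (≮⇒≥ gap≮h)))

    short∷⇒0<tail : ∀ {a S} → Short (a ∷ S) → 0 < sum S
    short∷⇒0<tail {a} {S} short@(a∈ ∷ _ , a+S≡x , _) = +-cancelˡ-< a 0 (sum S) (begin-strict
      a + 0      ≡⟨ +-identityʳ a ⟩
      a          ≤⟨ coin≤cm a∈ (short-coin≢L short (here refl)) ⟩
      cm         <⟨ <-≤-trans cm<L L≤x ⟩
      x          ≡⟨ a+S≡x ⟨
      a + sum S  ∎)

    gap≤r⇒twoCoins-<cm : gap ≤ r → ∀ a S → Short (a ∷ S) → sum S < cm → LargestCoin≤ (sum S) →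
      Σ ℕ λ a → Σ ℕ λ b → Coin a × Coin b × x ≡ a + b
    gap≤r⇒twoCoins-<cm gap≤r a S short@(a∈ ∷ _ , a+S≡x , _) S<cm
      G@record { coin = g ; coin∈ = g∈ ; coin≤y = g≤S ; maximal = maximal } with sum S ≟ g
    ... | yes S≡g = a , g , a∈ , g∈ , trans (sym a+S≡x) (cong (a +_) S≡g)
    ... | no  S≢g =
      ⊥-elim (gap≤r⇒¬short-block≥cm gap≤r (a ∷ g ∷ []) N
        (beatsGreedy-regreedyTail a S short (minimal _ S<x) G) (proj₂ (0<sum⇒nonempty N 0<N)) cm≤a+g)
      where
      N = greedyCoins (sum S ∸ g)
      S<x : sum S < x
      S<x = subst (sum S <_) a+S≡x (+-monoˡ-≤ (sum S) (coin-positive a∈))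
      0<N : 0 < sum N
      0<N = subst (0 <_) (sym (sum-greedyCoins (sum S ∸ g))) (m<n⇒0<n∸m (≤∧≢⇒< g≤S (S≢g ∘ sym)))
      S<g+gap : sum S < g + gap
      S<g+gap = let h , h∈ , h≤S , S<h+gap = coinWithinGap (short∷⇒0<tail short) (<-≤-trans S<cm (m≤m+n cm gap))
                in <-≤-trans S<h+gap (+-monoˡ-≤ gap (maximal h∈ h≤S))
      cm≤a+g : cm ≤ sum (a ∷ g ∷ [])
      cm≤a+g = subst (cm ≤_) (cong (a +_) (sym (+-identityʳ g))) (<⇒≤ (+-cancelʳ-< gap cm (a + g) (begin-strict
        cm + gap       ≡⟨ L≡cm+gap ⟨
        L              ≤⟨ L≤x ⟩
        x              ≡⟨ a+S≡x ⟨
        a + sum S      <⟨ +-monoʳ-< a S<g+gap ⟩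
        a + (g + gap)  ≡⟨ +-assoc a g gap ⟨
        a + g + gap    ∎)))

    gap≤r⇒twoCoins : gap ≤ r → ∀ a S → Short (a ∷ S) → Σ ℕ λ a → Σ ℕ λ b → Coin a × Coin b × x ≡ a + b
    gap≤r⇒twoCoins gap≤r a S short with cm ≤? sum S
    ... | yes cm≤S = ⊥-elim (gap≤r⇒¬short-block≥cm gap≤r S [ a ] (beatsGreedy-↭ (∷↭∷ʳ a S) short) (here refl) cm≤S)
    ... | no  cm≰S = gap≤r⇒twoCoins-<cm gap≤r a S short (≰⇒> cm≰S) (largestCoin≤ (short∷⇒0<tail short))

    twoCoins : Σ ℕ λ a → Σ ℕ λ b → Coin a × Coin b × x ≡ a + b
    twoCoins with r <? gap | O | O-short
    ... | yes r<gap | _     | _                 = ⊥-elim (r≮gap r<gap)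
    ... | no  _     | []    | (_ , sum≡x , _)   = ⊥-elim (<⇒≱ (<-≤-trans (≤-<-trans z≤n cm<L) L≤x) (≤-reflexive (sym sum≡x)))
    ... | no  r≮gap | a ∷ S | short             = gap≤r⇒twoCoins (≮⇒≥ r≮gap) a S short

  minimalCounterexample-twoCoins : ¬ Canonical S₂.cs → Tight S₃.cs → NoCounterexampleCmPlusCoin →
    ∀ x → Counterexample S₃.cs x → (∀ y → y < x → ¬ Counterexample S₃.cs y) →
    Σ ℕ λ a → Σ ℕ λ b → S₃.Coin a × S₃.Coin b × x ≡ a + b
  minimalCounterexample-twoCoins ¬canonical₂ tight₃ noCounterexample x ce minimal =
    MinimalCounterexample.twoCoins gap<cm noCounterexample x ce L≤x minimal
    where
    gap<cm : gap < cm
    gap<cm = ≰⇒> λ cm≤gap → ¬canonical₂ (cm≤gap⇒canonical₂ cm≤gap tight₃)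
    L≤x : L ≤ x
    L≤x = ≤-trans (∈⇒≤largest S₃.cs L∈₃) (≮⇒≥ λ x<largest → tight₃ x x<largest ce)

module _ {m} (c : ℕ → ℕ) (step : ∀ i → 2 ≤ i → i ≤ m → c i < c (suc i)) where

  increasing-< : ∀ {i j} → 2 ≤ i → i < j → j ≤ suc m → c i < c j
  increasing-< {i} {suc j} 2≤i i<1+j 1+j≤1+m with m<1+n⇒m<n∨m≡n i<1+j
  ... | inj₂ refl = step i 2≤i (s≤s⁻¹ 1+j≤1+m)
  ... | inj₁ i<j  = <-trans (increasing-< 2≤i i<j (<⇒≤ 1+j≤1+m)) (step j (≤-trans 2≤i (<⇒≤ i<j)) (s≤s⁻¹ 1+j≤1+m))

  increasing-≤ : ∀ {i j} → 2 ≤ i → i ≤ j → j ≤ suc m → c i ≤ c j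
  increasing-≤ 2≤i i≤j j≤1+m with m≤n⇒m<n∨m≡n i≤j
  ... | inj₁ i<j  = <⇒≤ (increasing-< 2≤i i<j j≤1+m)
  ... | inj₂ refl = ≤-refl

-- With m = 3 + k, system c m reduces to 1 ∷ ds, so S₂ below is ⟨1, c₂, …, c_m⟩ on the nose.
module SequenceSystem (k : ℕ) (c : ℕ → ℕ) (1<c₂ : 1 < c 2) (step : ∀ i → 2 ≤ i → i ≤ 3 + k → c i < c (suc i)) where

  f : ℕ → ℕ
  f i = c (2 + i)

  ds : List ℕ
  ds = map f (upTo (2 + k))

  system-suc : system c (4 + k) ≡ (1 ∷ ds) ∷ʳ c (4 + k)
  system-suc = cong (1 ∷_) (trans (cong (map f) (sym (upTo-∷ʳ (2 + k)))) (map-++ f (upTo (2 + k)) [ 2 + k ]))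

  1<f : ∀ {i} → i < 2 + k → 1 < f i
  1<f {i} i<2+k = <-≤-trans 1<c₂ (increasing-≤ c step (s≤s (s≤s z≤n)) (m≤m+n 2 i) (s≤s (s≤s (<⇒≤ i<2+k))))

  increasing : AllPairs _<_ (1 ∷ ds)
  increasing = subst (λ l → AllPairs _<_ (1 ∷ l)) (sym (map-upTo f (2 + k)))
    (All.applyUpTo⁺₁ f (2 + k) 1<f ∷
     AllPairs.applyUpTo⁺₁ f (2 + k) λ i<j j<2+k → increasing-< c step (s≤s (s≤s z≤n)) (s≤s (s≤s i<j)) (s≤s (s≤s (<⇒≤ j<2+k))))

  cm∈ : c (3 + k) ∈ 1 ∷ ds
  cm∈ = there (∈-map⁺ f (∈-upTo⁺ ≤-refl))

  ≤cm : ∀ {a} → a ∈ 1 ∷ ds → a ≤ c (3 + k)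
  ≤cm (here refl) = <⇒≤ (1<f ≤-refl)
  ≤cm (there a∈) with ∈-map⁻ f a∈
  ... | i , i∈ , refl = increasing-≤ c step (s≤s (s≤s z≤n)) (s≤s (s≤s (s≤s⁻¹ (∈-upTo⁻ i∈)))) (n≤1+n _)

  open TopCoin ds increasing (c (3 + k)) (c (4 + k)) cm∈ ≤cm (step (3 + k) (s≤s (s≤s z≤n)) ≤-refl) public

lemma3 : (m : ℕ) → 3 ≤ m → (c : ℕ → ℕ) →
    1 < c 2 → (∀ i → 2 ≤ i → i ≤ m → c i < c (suc i)) →
    Tight (system c 3) → Tight (system c m) → Tight (system c (suc m)) →
    Canonical (system c 3) → ¬ Canonical (system c m) → ¬ Canonical (system c (suc m)) →
    (∀ x → Counterexample (system c (suc m)) x →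
      ¬ ((Σ ℕ λ i → 2 ≤ i × i ≤ m × x ≡ c m + c i × c (suc m) < x)
         ⊎ (Σ ℕ λ j → 2 ≤ j × j ≤ m × x ≡ c (m ∸ 1) + c j × c (suc m) < x))) →
    ∀ x → Counterexample (system c (suc m)) x →
      (∀ y → y < x → ¬ Counterexample (system c (suc m)) y) →
      Σ ℕ λ a → Σ ℕ λ b → a ∈ system c (suc m) × b ∈ system c (suc m) × x ≡ a + b
lemma3 (suc (suc (suc k))) (s≤s (s≤s (s≤s z≤n))) c 1<c₂ step _ _ tight₃ _ ¬canonical₂ _ noCounterexample x ce minimal =
  let a , b , a∈ , b∈ , x≡a+b = minimalCounterexample-twoCoins ¬canonical₂ (subst Tight system-suc tight₃)
                                  noCounterexample′ x (toS₃ ce) (λ y y<x → minimal y y<x ∘ fromS₃)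
  in a , b , subst (a ∈_) (sym system-suc) a∈ , subst (b ∈_) (sym system-suc) b∈ , x≡a+b
  where
  open SequenceSystem k c 1<c₂ step
  toS₃ : ∀ {y} → Counterexample (system c (4 + k)) y → Counterexample S₃.cs y
  toS₃ {y} = subst (λ cs → Counterexample cs y) system-suc
  fromS₃ : ∀ {y} → Counterexample S₃.cs y → Counterexample (system c (4 + k)) y
  fromS₃ {y} = subst (λ cs → Counterexample cs y) (sym system-suc)
  noCounterexample′ : NoCounterexampleCmPlusCoin
  noCounterexample′ a∈ds L<cm+a ce′ with ∈-map⁻ f a∈ds
  ... | i , i∈ , refl = noCounterexample _ (fromS₃ ce′)
    (inj₁ (2 + i , s≤s (s≤s z≤n) , s≤s (s≤s (s≤s⁻¹ (∈-upTo⁻ i∈))) , refl , L<cm+a))
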